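{- Let $1\le k\le n$ and let $P\subseteq[n]$ with $|P|=k$. Then the function $f_P$ (defined in the context) satisfies $C(f_P,\mathbb{1}^n)=k$.
   Context: For $x\in\{0,1\}^n$ let $S_x=\{i:x_i=1\}$, and let $\mathbb{1}^n$ be the all-ones vector. For $P\subseteq[n]$ with $|P|=k$, define $f_P:\{0,1\}^n\to\{0,1\}$ by $f_P(x)=0$ if $|S_x|<k$; $f_P(x)=1$ if $|S_x|>k$; and if $|S_x|=k$, $f_P(x)=1$ iff $S_x=P$. For $x\in\{0,1\}^n$ and $S\subseteq[n]$, $x|_S$ is the restriction of $x$ to coordinates in $S$. A set $S\subseteq[n]$ is a certificate for $f$ at $x$ if every $y$ with $y|_S=x|_S$ satisfies $f(y)=f(x)$, and $C(f,x)$ is the minimum size of such a certificate. -}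

module Defs where

open import Data.Bool using (Bool; true; false)
open import Data.Bool.Properties using () renaming (_≟_ to _≟ᵇ_)
open import Data.Nat using (ℕ; _≤_; _<_)
open import Data.Nat.Properties using (<-cmp)
open import Data.Fin using (Fin)
open import Data.Fin.Subset using (Subset; ∣_∣; _∈_; ⊤)
open import Data.Vec using (Vec; lookup)
import Data.Vec.Properties as VecP
open import Relation.Binary.Definitions using (tri<; tri≈; tri>)
open import Relation.Binary.PropositionalEquality using (_≡_)
open import Relation.Nullary using (yes; no)
open import Data.Product using (Σ; _×_)

-- An input x ∈ {0,1}^n is a Vec Bool n; S_x = {i : x_i = 1} is x itself
-- viewed as a Subset n (true = 1).
Input : ℕ → Set
Input n = Vec Bool n

S : ∀ {n} → Input n → Subset n
S x = x

𝟙 : (n : ℕ) → Input n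
𝟙 n = ⊤

f : ∀ {n} → Subset n → Input n → Bool
f P x with <-cmp ∣ S x ∣ ∣ P ∣
... | tri< _ _ _ = false
... | tri> _ _ _ = true
... | tri≈ _ _ _ with VecP.≡-dec _≟ᵇ_ (S x) P
...   | yes _ = true
...   | no _  = false

IsCertificate : ∀ {n} → (Input n → Bool) → Input n → Subset n → Set
IsCertificate {n} g x T =
  (y : Input n) → (∀ (i : Fin n) → i ∈ T → lookup y i ≡ lookup x i) → g y ≡ g x

CertComplexityIs : ∀ {n} → (Input n → Bool) → Input n → ℕ → Set
CertComplexityIs {n} g x m =
  Σ (Subset n) (λ T → IsCertificate g x T × ∣ T ∣ ≡ m)
  × ((T : Subset n) → IsCertificate g x T → m ≤ ∣ T ∣)

{-# OPTIONS --safe #-}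
module Submission where

-- f_P is monotone and outputs 1 on every superset of P, so P is a certificate at 𝟙ⁿ.
-- Conversely, a certificate T with ∣T∣ < k fails: the input S_y = T agrees with 𝟙ⁿ
-- on T but has weight below k, so f_P(y) = 0 ≠ 1 = f_P(𝟙ⁿ).

open import Defs
open import Data.Bool using (true; false)
open import Data.Bool.Properties using () renaming (_≟_ to _≟ᵇ_)
open import Data.Empty using (⊥-elim)
open import Data.Fin.Subset using (Subset; ∣_∣; _∈_; _⊆_; ⊤)
open import Data.Fin.Subset.Properties
  using (_∈?_; ⊆-refl; ⊆-antisym; ⊆⊤; p⊆q⇒∣p∣≤∣q∣; p⊂q⇒∣p∣<∣q∣)
open import Data.Nat using (ℕ; _≤_; _<_)
open import Data.Nat.Properties using (<-cmp; <⇒≱; <⇒≢; <-asym; ≮⇒≥; ≤-reflexive)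
open import Data.Product using (_,_)
open import Data.Vec using (lookup)
open import Data.Vec.Properties using (≡-dec; lookup⇒[]=; []=⇒lookup; lookup-replicate)
open import Relation.Binary.Definitions using (tri<; tri≈; tri>)
open import Relation.Binary.PropositionalEquality using (_≡_; refl; sym; trans)
open import Relation.Nullary using (¬_; yes; no)

⊆∧∣∣≤⇒≡ : ∀ {n} {p q : Subset n} → p ⊆ q → ∣ q ∣ ≤ ∣ p ∣ → q ≡ p
⊆∧∣∣≤⇒≡ {p = p} {q} p⊆q ∣q∣≤∣p∣ = ⊆-antisym q⊆p p⊆q
  where
  q⊆p : q ⊆ p
  q⊆p {i} i∈q with i ∈? p
  ... | yes i∈p = i∈p
  ... | no  i∉p = ⊥-elim (<⇒≱ (p⊂q⇒∣p∣<∣q∣ (p⊆q , i , i∈q , i∉p)) ∣q∣≤∣p∣)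

f-⊇ : ∀ {n} (P x : Input n) → P ⊆ S x → f P x ≡ true
f-⊇ P x P⊆x with <-cmp ∣ S x ∣ ∣ P ∣
... | tri< ∣x∣<∣P∣ _ _ = ⊥-elim (<⇒≱ ∣x∣<∣P∣ (p⊆q⇒∣p∣≤∣q∣ P⊆x))
... | tri> _ _ _ = refl
... | tri≈ _ ∣x∣≡∣P∣ _ with ≡-dec _≟ᵇ_ (S x) P
...   | yes _   = refl
...   | no  x≢P = ⊥-elim (x≢P (⊆∧∣∣≤⇒≡ P⊆x (≤-reflexive ∣x∣≡∣P∣)))

f-< : ∀ {n} (P x : Input n) → ∣ S x ∣ < ∣ P ∣ → f P x ≡ false
f-< P x ∣x∣<∣P∣ with <-cmp ∣ S x ∣ ∣ P ∣
... | tri< _ _ _ = refl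
... | tri≈ _ ∣x∣≡∣P∣ _ = ⊥-elim (<⇒≢ ∣x∣<∣P∣ ∣x∣≡∣P∣)
... | tri> _ _ ∣P∣<∣x∣ = ⊥-elim (<-asym ∣x∣<∣P∣ ∣P∣<∣x∣)

agrees-with-𝟙⇒⊆ : ∀ {n} (T : Subset n) (y : Input n) →
  (∀ i → i ∈ T → lookup y i ≡ lookup (𝟙 n) i) → T ⊆ S y
agrees-with-𝟙⇒⊆ T y agree {i} i∈T =
  lookup⇒[]= i y (trans (agree i i∈T) (lookup-replicate i true))

⊆⇒agrees-with-𝟙 : ∀ {n} (T : Subset n) (y : Input n) → T ⊆ S y →
  ∀ i → i ∈ T → lookup y i ≡ lookup (𝟙 n) i
⊆⇒agrees-with-𝟙 T y T⊆y i i∈T =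
  trans ([]=⇒lookup (T⊆y i∈T)) (sym (lookup-replicate i true))

f-𝟙 : ∀ {n} (P : Subset n) → f P (𝟙 n) ≡ true
f-𝟙 P = f-⊇ P ⊤ ⊆⊤

f-certificate-at-𝟙 : ∀ {n} (P : Subset n) → IsCertificate (f P) (𝟙 n) P
f-certificate-at-𝟙 P y agree =
  trans (f-⊇ P y (agrees-with-𝟙⇒⊆ P y agree)) (sym (f-𝟙 P))

f-certificate-at-𝟙-large : ∀ {n} (P T : Subset n) →
  IsCertificate (f P) (𝟙 n) T → ∣ P ∣ ≤ ∣ T ∣
f-certificate-at-𝟙-large P T cert = ≮⇒≥ small-fails
  where
  small-fails : ¬ ∣ T ∣ < ∣ P ∣
  small-fails ∣T∣<∣P∣ with trans (sym (f-< P T ∣T∣<∣P∣))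
                            (trans (cert T (⊆⇒agrees-with-𝟙 T T ⊆-refl)) (f-𝟙 P))
  ... | ()

lemma5p1 : (n k : ℕ) → 1 ≤ k → k ≤ n → (P : Subset n) → ∣ P ∣ ≡ k →
    CertComplexityIs (f P) (𝟙 n) k
lemma5p1 n k _ _ P refl =
  (P , f-certificate-at-𝟙 P , refl) , f-certificate-at-𝟙-large P
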